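{- The set of $\mathcal{P}$-positions of $\mathcal{R}$-Wythoff equals the set of $\mathcal{P}$-positions of Wythoff's game, namely the set of positions $\{(\lfloor \phi n\rfloor, \lfloor \phi n\rfloor + n) : n \geq 0\}$ (positions being unordered), where $\phi = (1+\sqrt{5})/2$.
   Context: A position is an unordered pair $(a,b)$ of nonnegative integers (pile sizes); $(a,b)$ and $(b,a)$ are the same position. Two players alternate moves; the player making the last move wins. In Wythoff's game a move either removes a positive number of tokens from one pile, or removes the same positive number of tokens from both piles. $\mathcal{R}$-Wythoff is the restriction of Wythoff's game in which a move either removes a positive number of tokens from the larger pile (or from either pile if the two piles have equal size), or removes the same positive number of tokens from both piles; in particular, when the piles are unequal, removing tokens from only the smaller pile is not allowed. A $\mathcal{P}$-position is a position from which the player about to move has no winning strategy (equivalently, the positions of Sprague-Grundy value $0$). -}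

module Defs where

open import Data.Nat using (ℕ; _+_; _*_; _∸_; _≤_; _<_)
open import Data.Product using (_×_; ∃; ∃-syntax)
open import Data.Sum using (_⊎_)
open import Relation.Binary.PropositionalEquality using (_≡_)

-- Both move relations below are
-- symmetric under swapping the piles, so (a , b) and (b , a) have the same
-- outcome; unordered positions are represented by ordered pairs.
Pos : Set
Pos = ℕ × ℕ

open import Data.Product using (_,_)

data WMove : Pos → Pos → Set where
  left  : ∀ {a a' b} → a' < a → WMove (a , b) (a' , b)
  right : ∀ {a b b'} → b' < b → WMove (a , b) (a , b')
  diag  : ∀ {a b k} → 0 < k → k ≤ a → k ≤ b → WMove (a , b) (a ∸ k , b ∸ k)

data RMove : Pos → Pos → Set where
  left  : ∀ {a a' b} → b ≤ a → a' < a → RMove (a , b) (a' , b)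
  right : ∀ {a b b'} → a ≤ b → b' < b → RMove (a , b) (a , b')
  diag  : ∀ {a b k} → 0 < k → k ≤ a → k ≤ b → RMove (a , b) (a ∸ k , b ∸ k)

mutual
  data IsP (Move : Pos → Pos → Set) (p : Pos) : Set where
    isP : (∀ q → Move p q → IsN Move q) → IsP Move p

  data IsN (Move : Pos → Pos → Set) (p : Pos) : Set where
    isN : ∀ q → Move p q → IsP Move q → IsN Move p

-- FloorPhi n k  ⇔  k = ⌊ φ n ⌋  with φ = (1 + √5)/2, i.e.  k ≤ φ n < k + 1.
-- Since φ n = (n + √5 n)/2:
--   k ≤ φ n      ⇔  2k - n ≤ √5 n      ⇔  (2k ∸ n)² ≤ 5 n²        (over ℕ)
--   φ n < k + 1  ⇔  √5 n < 2(k+1) - n  ⇔  5 n² < (2(k+1) ∸ n)²    (over ℕ;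
--   the strict inequality forces 2(k+1) > n, so truncation is harmless)
FloorPhi : ℕ → ℕ → Set
FloorPhi n k =
  ((2 * k ∸ n) * (2 * k ∸ n) ≤ 5 * (n * n)) ×
  (5 * (n * n) < (2 * (k + 1) ∸ n) * (2 * (k + 1) ∸ n))

InWythoffSet : Pos → Set
InWythoffSet (a , b) =
  ∃[ n ] ∃[ k ] FloorPhi n k ×
    ((a ≡ k × b ≡ k + n) ⊎ (a ≡ k + n × b ≡ k))

module Submission where

-- (1) Kernel lemma: in a terminating game, a set of positions that is
--     independent (no move stays inside it) and absorbing (every position
--     outside has a move into it) is exactly the set of P-positions.
-- (2) Arithmetic of φ without reals: "x ≤ φ n" is encoded as x² ≤ x n + n² and
--     "φ m ≤ n" as n m + m² ≤ n².  The key facts are the shift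
--     n + m ≤ φ n ⇔ φ m ≤ n, the irrationality of φ (by descent), and
--     monotonicity.
-- (3) With A n = ⌊φ n⌋ and B n = A n + n, both sequences are strictly
--     increasing and complementary: every number lies in exactly one of them,
--     except A 0 = B 0 = 0.
-- (4) Hence the pairs {A n , B n} are independent for Wythoff moves (one pile
--     determines the other, and the difference of the piles determines the
--     pair) and absorbing already for R-Wythoff moves.  As every R-Wythoff
--     move is a Wythoff move, the kernel lemma applies to both games.
-- (5) The description FloorPhi of ⌊φ n⌋ (with √5 cleared) agrees with
--     the encoding of (2), which identifies the pairs with InWythoffSet.

open import Data.Nat
open import Data.Nat.Properties
open import Data.Nat.Induction using (<-wellFounded)
open import Data.Nat.Tactic.RingSolver using (solve-∀)
open import Data.Product using (_×_; _,_; proj₁; proj₂; ∃-syntax)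
open import Data.Sum using (_⊎_; inj₁; inj₂)
open import Data.Empty using (⊥; ⊥-elim)
open import Function using (flip)
open import Function.Bundles using (_⇔_; mk⇔; Equivalence)
open import Function.Construct.Composition using (_⇔-∘_)
open import Function.Construct.Symmetry using (⇔-sym)
open import Induction.WellFounded using (WellFounded; Acc; acc; module Subrelation)
open import Relation.Binary.Construct.On as On using ()
open import Relation.Binary.Definitions using (tri<; tri≈; tri>)
open import Relation.Binary.PropositionalEquality
open import Relation.Nullary using (¬_; Dec; yes; no)
open import Relation.Unary using (Decidable)

open import Defs

P-excludes-N : ∀ {Move p} → IsP Move p → IsN Move p → ⊥
P-excludes-N (isP allN) (isN q mv qP) = P-excludes-N qP (allN q mv)

module Kernel (Move : Pos → Pos → Set) (terminating : WellFounded (flip Move))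
              (S : Pos → Set)
              (independent : ∀ {p q} → Move p q → S p → S q → ⊥)
              (absorbing : ∀ p → S p ⊎ ∃[ q ] (Move p q × S q)) where

  mutual
    kernel-is-P : ∀ {p} → Acc (flip Move) p → S p → IsP Move p
    kernel-is-P (acc rec) sp =
      isP λ q mv → outside-is-N (rec mv) (independent mv sp)

    outside-is-N : ∀ {q} → Acc (flip Move) q → ¬ S q → IsN Move q
    outside-is-N {q} (acc rec) q∉S with absorbing q
    ... | inj₁ q∈S = ⊥-elim (q∉S q∈S)
    ... | inj₂ (r , mv , r∈S) = isN r mv (kernel-is-P (rec mv) r∈S)

  P⇒kernel : ∀ {p} → IsP Move p → S p
  P⇒kernel {p} pP with absorbing p
  ... | inj₁ p∈S = p∈S
  ... | inj₂ (q , mv , q∈S) =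
    ⊥-elim (P-excludes-N pP (isN q mv (kernel-is-P (terminating q) q∈S)))

  P⇔kernel : ∀ p → IsP Move p ⇔ S p
  P⇔kernel p = mk⇔ P⇒kernel (kernel-is-P (terminating p))

tokens : Pos → ℕ
tokens (a , b) = a + b

WMove-decreases : ∀ {p q} → WMove p q → tokens q < tokens p
WMove-decreases {_ , b} (left a'<a) = +-monoˡ-< b a'<a
WMove-decreases {a , _} (right b'<b) = +-monoʳ-< a b'<b
WMove-decreases {_ , b} (diag {k = t} 0<t t≤a _) =
  +-mono-<-≤ (∸-monoʳ-< 0<t t≤a) (m∸n≤m b t)

WMove-terminating : WellFounded (flip WMove)
WMove-terminating =
  Subrelation.wellFounded WMove-decreases (On.wellFounded tokens <-wellFounded)

RMove⇒WMove : ∀ {p q} → RMove p q → WMove p q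
RMove⇒WMove (left _ a'<a) = left a'<a
RMove⇒WMove (right _ b'<b) = right b'<b
RMove⇒WMove (diag 0<t t≤a t≤b) = diag 0<t t≤a t≤b

RMove-terminating : WellFounded (flip RMove)
RMove-terminating = Subrelation.wellFounded RMove⇒WMove WMove-terminating

RMove-swap : ∀ {a b c d} → RMove (a , b) (c , d) → RMove (b , a) (d , c)
RMove-swap (left b≤a a'<a) = right b≤a a'<a
RMove-swap (right a≤b b'<b) = left a≤b b'<b
RMove-swap (diag 0<t t≤a t≤b) = diag 0<t t≤b t≤a

-- The identity behind  n + m ≤ φ n ⇔ φ m ≤ n  (that is, φ n − n = n / φ):
-- (n + m)² and (n + m) n + n² exceed  n m + m²  and  n²  by the same amount.
square-split : ∀ n m → (n + m) * (n + m) ≡ (n * m + m * m) + (n * n + n * m)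
square-split = solve-∀

product-split : ∀ n m → (n + m) * n + n * n ≡ n * n + (n * n + n * m)
product-split = solve-∀

descend : ∀ n a → (n + a) * (n + a) ≡ (n + a) * n + n * n → n * n ≡ n * a + a * a
descend n a eq = sym (+-cancelʳ-≡ (n * n + n * a) _ _
  (trans (sym (square-split n a)) (trans eq (product-split n a))))

-- φ is irrational: x² = x n + n² forces n = 0.  A solution with n > 0 has
-- n < x (else x² ≤ x n < x n + n²), so descending gives a solution with a
-- smaller first component; at a = 0 the descended equation reads n² = 0.
φ-irrational : ∀ {x n} → x * x ≡ x * n + n * n → n ≡ 0
φ-irrational {x} = descent (<-wellFounded x)
  where
  open ≤-Reasoning

  descent : ∀ {x n} → Acc _<_ x → x * x ≡ x * n + n * n → n ≡ 0
  descent {x} {zero} _ _ = refl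
  descent {x} {suc n} (acc rec) eq with x ≤? suc n
  ... | yes x≤n = ⊥-elim (<-irrefl eq (begin-strict
          x * x                     ≤⟨ *-monoʳ-≤ x x≤n ⟩
          x * suc n                 <⟨ m<m+n (x * suc n) z<s ⟩
          x * suc n + suc n * suc n ∎))
  ... | no x≰n with m≤n⇒∃[o]m+o≡n (<⇒≤ (≰⇒> x≰n))
  ... | a , refl with descent {n = a} (rec (≰⇒> x≰n)) (descend (suc n) a eq)
  ...   | refl = ⊥-elim (0≢1+n (sym (trans (descend (suc n) 0 eq)
                   (trans (+-identityʳ (suc n * 0)) (*-zeroʳ (suc n))))))

-- The two comparisons with multiples of φ are kept opaque: every later
-- argument uses only the lemmas proved about them below.
infix 4 _≤φ·_ φ·_≤_ _≤φ·?_ φ·_≤?_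

opaque
  -- x ≤φ· n  expresses  x ≤ φ n  without irrationals: φ is the positive root
  -- of t² = t + 1, so for x, n ≥ 0 it is equivalent to  x² ≤ x n + n².
  _≤φ·_ : ℕ → ℕ → Set
  x ≤φ· n = x * x ≤ x * n + n * n

  -- φ· m ≤ n  expresses  φ m ≤ n, i.e.  m ≤ n / φ, i.e.  n m + m² ≤ n².
  φ·_≤_ : ℕ → ℕ → Set
  φ· m ≤ n = n * m + m * m ≤ n * n

opaque
  unfolding _≤φ·_ φ·_≤_

  _≤φ·?_ : ∀ x n → Dec (x ≤φ· n)
  x ≤φ·? n = x * x ≤? x * n + n * n

  φ·_≤?_ : ∀ m n → Dec (φ· m ≤ n)
  φ· m ≤? n = n * m + m * m ≤? n * n

  φ·≰⇒≤φ· : ∀ {m n} → ¬ φ· m ≤ n → n ≤φ· m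
  φ·≰⇒≤φ· h = <⇒≤ (≰⇒> h)

  ≤φ·⇒φ·≤ : ∀ n m → n + m ≤φ· n → φ· m ≤ n
  ≤φ·⇒φ·≤ n m h = +-cancelʳ-≤ (n * n + n * m) _ _
    (subst₂ _≤_ (square-split n m) (product-split n m) h)

  φ·≤⇒≤φ· : ∀ n m → φ· m ≤ n → n + m ≤φ· n
  φ·≤⇒≤φ· n m h = subst₂ _≤_ (sym (square-split n m)) (sym (product-split n m))
    (+-monoˡ-≤ (n * n + n * m) h)

  ≤φ·-φ·≤-antisym : ∀ {n m} → n ≤φ· m → φ· m ≤ n → m ≡ 0
  ≤φ·-φ·≤-antisym {n} {m} l g = φ-irrational {n} {m} (≤-antisym l g)

  ≤⇒≤φ· : ∀ {x n} → x ≤ n → x ≤φ· n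
  ≤⇒≤φ· {x} {n} x≤n = ≤-trans (*-monoʳ-≤ x x≤n) (m≤m+n (x * n) (n * n))

  ≤φ·-monoʳ : ∀ {x n n'} → n ≤ n' → x ≤φ· n → x ≤φ· n'
  ≤φ·-monoʳ {x} n≤n' l =
    ≤-trans l (+-mono-≤ (*-monoʳ-≤ x n≤n') (*-mono-≤ n≤n' n≤n'))

  φ·≤-antiˡ : ∀ {m m' n} → m ≤ m' → φ· m' ≤ n → φ· m ≤ n
  φ·≤-antiˡ {n = n} m≤m' g =
    ≤-trans (+-mono-≤ (*-monoʳ-≤ n m≤m') (*-mono-≤ m≤m' m≤m')) g

  -- x ≤ φ n  is downward closed in x.  For x ≤ n this is φ ≥ 1; otherwise
  -- x = n + a, and the shift turns it into monotonicity of  φ a ≤ n  in a.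
  ≤φ·-antiˡ : ∀ {x x' n} → x ≤ x' → x' ≤φ· n → x ≤φ· n
  ≤φ·-antiˡ {x} {x'} {n} x≤x' l with x ≤? n
  ... | yes x≤n = ≤⇒≤φ· x≤n
  ... | no x≰n with m≤n⇒∃[o]m+o≡n (<⇒≤ (≰⇒> x≰n))
                  | m≤n⇒∃[o]m+o≡n (≤-trans (<⇒≤ (≰⇒> x≰n)) x≤x')
  ... | a , refl | a' , refl =
    φ·≤⇒≤φ· n a (φ·≤-antiˡ {n = n} (+-cancelˡ-≤ n _ _ x≤x')
                                    (≤φ·⇒φ·≤ n a' l))

  -- φ < 2:  2n + 1 exceeds φ n, so  x ≤ φ n  implies  x ≤ 2n.
  odd-square : ∀ n → (2 * n + 1) * (2 * n + 1)
                   ≡ ((2 * n + 1) * n + n * n) + suc (n * n + 3 * n)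
  odd-square = solve-∀

  ≤φ·-bound : ∀ {x n} → x ≤φ· n → x ≤ 2 * n
  ≤φ·-bound {x} {n} l with x ≤? 2 * n
  ... | yes x≤2n = x≤2n
  ... | no x≰2n = ⊥-elim (m+1+n≰m R (subst (_≤ R) (odd-square n) 2n+1≤φ·n))
    where
    R : ℕ
    R = (2 * n + 1) * n + n * n
    2n+1≤φ·n : 2 * n + 1 ≤φ· n
    2n+1≤φ·n = ≤φ·-antiˡ (subst (_≤ x) (+-comm 1 (2 * n)) (≰⇒> x≰2n)) l

  -- φ ≥ 1 once more:  x ≤ φ n  implies  x + 1 ≤ φ (n + 1), because the increase
  -- 2x + 1 of the left side is at most the increase x + 3n + 2 of the right.
  suc-square : ∀ x → suc x * suc x ≡ x * x + (x + suc x)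
  suc-square = solve-∀

  suc-product : ∀ x n → suc x * suc n + suc n * suc n
                      ≡ (x * n + n * n) + (x + suc (2 * n + suc n))
  suc-product = solve-∀

  ≤φ·-suc : ∀ {x n} → x ≤φ· n → suc x ≤φ· suc n
  ≤φ·-suc {x} {n} l = subst₂ _≤_ (sym (suc-square x)) (sym (suc-product x n))
    (+-mono-≤ l (+-monoʳ-≤ x (s≤s (≤-trans (≤φ·-bound l) (m≤m+n (2 * n) (suc n))))))

  φ·0≤ : ∀ n → φ· 0 ≤ n
  φ·0≤ n = subst (_≤ n * n) (sym (trans (+-identityʳ (n * 0)) (*-zeroʳ n))) z≤n

  φ·suc≰0 : ∀ m → ¬ φ· suc m ≤ 0
  φ·suc≰0 m ()

IsFloorφ : ℕ → ℕ → Set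
IsFloorφ n k = k ≤φ· n × ¬ suc k ≤φ· n

switch-point : ∀ {P : ℕ → Set} → Decidable P →
               ∀ y → P 0 → ¬ P y → ∃[ m ] (m < y × P m × ¬ P (suc m))
switch-point P? zero p0 ¬py = ⊥-elim (¬py p0)
switch-point P? (suc y) p0 ¬py with P? y
... | yes py = y , ≤-refl , py , ¬py
... | no ¬py' with switch-point P? y p0 ¬py'
...   | m , m<y , pm , ¬pm' = m , m<n⇒m<1+n m<y , pm , ¬pm'

floorφ-exists : ∀ n → ∃[ k ] IsFloorφ n k
floorφ-exists n with switch-point (_≤φ·? n) (2 * n + 1) (≤⇒≤φ· z≤n)
                       (λ l → m+1+n≰m (2 * n) (≤φ·-bound l))
... | k , _ , k≤φn , k+1≰φn = k , k≤φn , k+1≰φn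

-- The lower Wythoff sequence A n = ⌊φ n⌋ and the upper one B n = A n + n.
-- A is opaque: only its defining property A-floor is used.
opaque
  A : ℕ → ℕ
  A n = proj₁ (floorφ-exists n)

  A-floor : ∀ n → IsFloorφ n (A n)
  A-floor n = proj₂ (floorφ-exists n)

B : ℕ → ℕ
B n = A n + n

floor-greatest : ∀ {k k' n} → k ≤φ· n → IsFloorφ n k' → k ≤ k'
floor-greatest {k} {k'} k≤φn (_ , k'+1≰φn) with k ≤? k'
... | yes k≤k' = k≤k'
... | no k≰k' = ⊥-elim (k'+1≰φn (≤φ·-antiˡ (≰⇒> k≰k') k≤φn))

A-unique : ∀ {n k} → IsFloorφ n k → k ≡ A n
A-unique {n} k-floor =
  ≤-antisym (floor-greatest (proj₁ k-floor) (A-floor n))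
            (floor-greatest (proj₁ (A-floor n)) k-floor)

A-zero : A 0 ≡ 0
A-zero = n≤0⇒n≡0 (≤φ·-bound (proj₁ (A-floor 0)))

n≤A : ∀ n → n ≤ A n
n≤A n = floor-greatest (≤⇒≤φ· ≤-refl) (A-floor n)

-- Since φ ≥ 1, both sequences are strictly increasing.
A-strict : ∀ {m n} → m < n → A m < A n
A-strict {m} {n} m<n =
  floor-greatest (≤φ·-monoʳ m<n (≤φ·-suc (proj₁ (A-floor m)))) (A-floor n)

B-strict : ∀ {m n} → m < n → B m < B n
B-strict m<n = +-mono-< (A-strict m<n) m<n

strict⇒injective : ∀ {f : ℕ → ℕ} → (∀ {m n} → m < n → f m < f n) →
                   ∀ {m n} → f m ≡ f n → m ≡ n
strict⇒injective f-strict {m} {n} fm≡fn with <-cmp m n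
... | tri< m<n _ _ = ⊥-elim (<-irrefl fm≡fn (f-strict m<n))
... | tri≈ _ m≡n _ = m≡n
... | tri> _ _ n<m = ⊥-elim (<-irrefl (sym fm≡fn) (f-strict n<m))

A-injective : ∀ {m n} → A m ≡ A n → m ≡ n
A-injective = strict⇒injective A-strict

B-injective : ∀ {m n} → B m ≡ B n → m ≡ n
B-injective = strict⇒injective B-strict

-- A and B are disjoint apart from A 0 = B 0.  Suppose A n = B m and write
-- A n = n + j.  If m ≤ j, then n ≤ A m ≤ φ m ≤ φ j, while  n + j ≤ φ n  gives
-- φ j ≤ n; irrationality forces j = 0, so m = 0.  If j < m, then A m < n,
-- and  A n + 1 = n + (j + 1) > φ n  gives  n ≤ φ (j + 1) ≤ φ m; then
-- A m + 1 ≤ φ m, contradicting A m = ⌊φ m⌋.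
A≡B⇒index0 : ∀ {n m} → A n ≡ B m → m ≡ 0
A≡B⇒index0 {n} {m} An≡Bm with m≤n⇒∃[o]m+o≡n (n≤A n)
... | j , n+j≡An with m ≤? j
...   | yes m≤j = n≤0⇒n≡0 (subst (m ≤_) j≡0 m≤j)
  where
  n≤Am : n ≤ A m
  n≤Am = +-cancelʳ-≤ m n (A m)
    (subst (n + m ≤_) (trans n+j≡An An≡Bm) (+-monoʳ-≤ n m≤j))
  j≡0 : j ≡ 0
  j≡0 = ≤φ·-φ·≤-antisym
    (≤φ·-antiˡ n≤Am (≤φ·-monoʳ m≤j (proj₁ (A-floor m))))
    (≤φ·⇒φ·≤ n j (subst (_≤φ· n) (sym n+j≡An) (proj₁ (A-floor n))))
...   | no m≰j = ⊥-elim (proj₂ (A-floor m)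
                   (≤φ·-antiˡ Am<n (≤φ·-monoʳ (≰⇒> m≰j) n≤φ[j+1])))
  where
  Am<n : suc (A m) ≤ n
  Am<n = +-cancelʳ-≤ j (suc (A m)) n (subst (_≤ n + j) (+-suc (A m) j)
    (≤-trans (+-monoʳ-≤ (A m) (≰⇒> m≰j))
             (≤-reflexive (sym (trans n+j≡An An≡Bm)))))
  n≤φ[j+1] : n ≤φ· suc j
  n≤φ[j+1] = φ·≰⇒≤φ· λ φ[j+1]≤n → proj₂ (A-floor n)
    (subst (_≤φ· n) (trans (+-suc n j) (cong suc n+j≡An))
                    (φ·≤⇒≤φ· n (suc j) φ[j+1]≤n))

A≡B⇒trivial : ∀ {n m} → A n ≡ B m → n ≡ 0 × m ≡ 0
A≡B⇒trivial An≡Bm with A≡B⇒index0 An≡Bm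
... | refl = A-injective (trans An≡Bm (+-identityʳ (A 0))) , refl

-- At a switch point  φ m ≤ o + 1,  φ (m + 1) ≰ o,  the number m + o + 1 is
-- A (o + 1) if also  φ (m + 1) ≰ o + 1; otherwise  o = A (m + 1), so it is
-- B (m + 1).
switch-value : ∀ {m o} → φ· m ≤ suc o → ¬ φ· suc m ≤ o →
               A (suc o) ≡ suc o + m ⊎ A (suc m) ≡ o
switch-value {m} {o} φm≤o+1 φ[m+1]≰o with φ· suc m ≤? suc o
... | no φ[m+1]≰o+1 = inj₁ (sym (A-unique (φ·≤⇒≤φ· (suc o) m φm≤o+1 ,
        λ l → φ[m+1]≰o+1 (≤φ·⇒φ·≤ (suc o) (suc m)
                 (subst (_≤φ· suc o) (sym (+-suc (suc o) m)) l)))))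
... | yes φ[m+1]≤o+1 = inj₂ (sym (A-unique (φ·≰⇒≤φ· φ[m+1]≰o ,
        λ l → 0≢1+n (sym (≤φ·-φ·≤-antisym l φ[m+1]≤o+1)))))

-- Splitting y + 1 = m + (o + 1) at the switch point m of  φ m ≤ y + 1 − m,
-- which holds at m = 0 and fails at m = y + 1.
switch-decomposition : ∀ y →
  ∃[ m ] ∃[ o ] (m + o ≡ y × φ· m ≤ suc o × ¬ φ· suc m ≤ o)
switch-decomposition y
  with switch-point (λ m → φ· m ≤? suc y ∸ m) (suc y)
         (φ·0≤ (suc y))
         (subst (λ z → ¬ φ· suc y ≤ z) (sym (n∸n≡0 y)) (φ·suc≰0 y))
... | m , m<y+1 , φm≤ , φ[m+1]≰ with m≤n⇒∃[o]m+o≡n (s≤s⁻¹ m<y+1)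
...   | o , refl = m , o , refl , subst (φ· m ≤_) m+o+1∸m≡o+1 φm≤ ,
                   subst (λ z → ¬ φ· suc m ≤ z) (m+n∸m≡n m o) φ[m+1]≰
  where
  m+o+1∸m≡o+1 : suc (m + o) ∸ m ≡ suc o
  m+o+1∸m≡o+1 = trans (cong (_∸ m) (sym (+-suc m o))) (m+n∸m≡n m (suc o))

A-or-B : ∀ y → (∃[ n ] A n ≡ y) ⊎ (∃[ m ] (0 < m × B m ≡ y))
A-or-B zero = inj₁ (0 , A-zero)
A-or-B (suc y) with switch-decomposition y
... | m , o , refl , φm≤o+1 , φ[m+1]≰o with switch-value φm≤o+1 φ[m+1]≰o
...   | inj₁ A[o+1]≡o+1+m = inj₁ (suc o , trans A[o+1]≡o+1+m (cong suc (+-comm o m)))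
...   | inj₂ A[m+1]≡o = inj₂ (suc m , z<s , (begin
        A (suc m) + suc m ≡⟨ cong (_+ suc m) A[m+1]≡o ⟩
        o + suc m         ≡⟨ +-suc o m ⟩
        suc (o + m)       ≡⟨ cong suc (+-comm o m) ⟩
        suc (m + o)       ∎))
  where open ≡-Reasoning

WythoffPair : Pos → Set
WythoffPair (a , b) = ∃[ n ] ((a ≡ A n × b ≡ B n) ⊎ (a ≡ B n × b ≡ A n))

wythoff-swap : ∀ {a b} → WythoffPair (a , b) → WythoffPair (b , a)
wythoff-swap (n , inj₁ (a≡ , b≡)) = n , inj₂ (b≡ , a≡)
wythoff-swap (n , inj₂ (a≡ , b≡)) = n , inj₁ (b≡ , a≡)

wythoff-partner : ∀ {a b b'} → WythoffPair (a , b) → WythoffPair (a , b') → b ≡ b'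
wythoff-partner (n , inj₁ (refl , refl)) (n' , inj₁ (An≡An' , refl)) =
  cong B (A-injective An≡An')
wythoff-partner (n , inj₁ (refl , refl)) (n' , inj₂ (An≡Bn' , refl))
  with A≡B⇒trivial An≡Bn'
... | refl , refl = +-identityʳ (A 0)
wythoff-partner (n , inj₂ (refl , refl)) (n' , inj₁ (Bn≡An' , refl))
  with A≡B⇒trivial (sym Bn≡An')
... | refl , refl = sym (+-identityʳ (A 0))
wythoff-partner (n , inj₂ (refl , refl)) (n' , inj₂ (Bn≡Bn' , refl)) =
  cong A (B-injective Bn≡Bn')

B+d≡A⇒trivial : ∀ {n d} → B n + d ≡ A n → n ≡ 0 × d ≡ 0
B+d≡A⇒trivial {n} {d} Bn+d≡An = m+n≡0⇒m≡0 n n+d≡0 , m+n≡0⇒n≡0 n n+d≡0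
  where
  n+d≡0 : n + d ≡ 0
  n+d≡0 = +-cancelˡ-≡ (A n) (n + d) 0
    (trans (sym (+-assoc (A n) n d)) (trans Bn+d≡An (sym (+-identityʳ (A n)))))

wythoff-gap : ∀ {a d} → WythoffPair (a , a + d) → a ≡ A d
wythoff-gap {d = d} (n , inj₁ (refl , An+d≡Bn)) =
  cong A (sym (+-cancelˡ-≡ (A n) d n An+d≡Bn))
wythoff-gap (n , inj₂ (refl , Bn+d≡An)) with B+d≡A⇒trivial Bn+d≡An
... | refl , refl = +-identityʳ (A 0)

-- A diagonal move keeps the difference of the piles, which by wythoff-gap
-- determines the smaller pile of a Wythoff pair; so it cannot join two pairs.
no-diagonal-≤ : ∀ {a d t} → 0 < t → t ≤ a → WythoffPair (a , a + d) →
                WythoffPair (a ∸ t , (a + d) ∸ t) → ⊥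
no-diagonal-≤ {a} {d} {t} 0<t t≤a from to =
  <-irrefl (trans (wythoff-gap to') (sym (wythoff-gap from))) (∸-monoʳ-< 0<t t≤a)
  where
  to' : WythoffPair (a ∸ t , (a ∸ t) + d)
  to' = subst (λ z → WythoffPair (a ∸ t , z)) (+-∸-comm d t≤a) to

no-diagonal : ∀ {a b t} → 0 < t → t ≤ a → t ≤ b → WythoffPair (a , b) →
              WythoffPair (a ∸ t , b ∸ t) → ⊥
no-diagonal {a} {b} 0<t t≤a t≤b from to with ≤-total a b
... | inj₁ a≤b with m≤n⇒∃[o]m+o≡n a≤b
...   | d , refl = no-diagonal-≤ 0<t t≤a from to
no-diagonal {a} {b} 0<t t≤a t≤b from to | inj₂ b≤a with m≤n⇒∃[o]m+o≡n b≤a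
...   | d , refl = no-diagonal-≤ 0<t t≤b (wythoff-swap from) (wythoff-swap to)

wythoff-independent : ∀ {p q} → WMove p q → WythoffPair p → WythoffPair q → ⊥
wythoff-independent (left a'<a) from to =
  <-irrefl (wythoff-partner (wythoff-swap to) (wythoff-swap from)) a'<a
wythoff-independent (right b'<b) from to = <-irrefl (wythoff-partner to from) b'<b
wythoff-independent (diag 0<t t≤a t≤b) from to = no-diagonal 0<t t≤a t≤b from to

-- If a = B m with m > 0, take the larger pile down to
-- A m < a.  If a = A n: for d = n it is a pair; for d > n take the larger pile
-- down to B n; for d < n move diagonally to (A d , A d + d), as A d < A n.
wythoff-reachable-≤ : ∀ a d →
  WythoffPair (a , a + d) ⊎ ∃[ q ] (RMove (a , a + d) q × WythoffPair q)
wythoff-reachable-≤ a d with A-or-B a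
... | inj₂ (m , 0<m , refl) =
  inj₂ ((B m , A m) , right (m≤m+n (B m) d) Am<Bm+d , m , inj₂ (refl , refl))
  where
  Am<Bm+d : A m < B m + d
  Am<Bm+d = ≤-trans (m<m+n (A m) 0<m) (m≤m+n (B m) d)
... | inj₁ (n , refl) with <-cmp d n
...   | tri≈ _ refl _ = inj₁ (n , inj₁ (refl , refl))
...   | tri> _ _ n<d =
  inj₂ ((A n , B n) , right (m≤m+n (A n) d) (+-monoʳ-< (A n) n<d) ,
        n , inj₁ (refl , refl))
...   | tri< d<n _ _ =
  inj₂ ((A n ∸ t , (A n + d) ∸ t) ,
        diag (m<n⇒0<n∸m Ad<An) t≤An (≤-trans t≤An (m≤m+n (A n) d)) ,
        d , inj₁ (lands , trans (+-∸-comm d t≤An) (cong (_+ d) lands)))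
  where
  Ad<An : A d < A n
  Ad<An = A-strict d<n
  t : ℕ
  t = A n ∸ A d
  t≤An : t ≤ A n
  t≤An = m∸n≤m (A n) (A d)
  lands : A n ∸ t ≡ A d
  lands = m∸[m∸n]≡n (<⇒≤ Ad<An)

wythoff-reachable : ∀ p → WythoffPair p ⊎ ∃[ q ] (RMove p q × WythoffPair q)
wythoff-reachable (a , b) with ≤-total a b
... | inj₁ a≤b with m≤n⇒∃[o]m+o≡n a≤b
...   | d , refl = wythoff-reachable-≤ a d
wythoff-reachable (a , b) | inj₂ b≤a with m≤n⇒∃[o]m+o≡n b≤a
...   | d , refl with wythoff-reachable-≤ b d
...     | inj₁ pair = inj₁ (wythoff-swap pair)
...     | inj₂ ((c , e) , mv , pair) = inj₂ ((e , c) , RMove-swap mv , wythoff-swap pair)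

-- Clearing the square root:  x ≤ φ n = (n + √5 n) / 2  ⇔  (2x ∸ n)² ≤ 5 n².
-- If 2x < n both sides hold.  Otherwise 2x = n + d, and multiplying
-- x² ≤ x n + n² by 4 gives  d² ≤ 5 n²  with both sides shifted by n² + 2 n d.
four-square : ∀ x → 4 * (x * x) ≡ (2 * x) * (2 * x)
four-square = solve-∀

four-product : ∀ x n → 4 * (x * n + n * n) ≡ 2 * n * (2 * x) + 4 * (n * n)
four-product = solve-∀

sum-square : ∀ n d → (n + d) * (n + d) ≡ d * d + (n * n + 2 * (n * d))
sum-square = solve-∀

sum-product : ∀ n d →
  2 * n * (n + d) + 4 * (n * n) ≡ 5 * (n * n) + (n * n + 2 * (n * d))
sum-product = solve-∀

opaque
  unfolding _≤φ·_

  sqrt5-criterion : ∀ x n → (2 * x ∸ n) * (2 * x ∸ n) ≤ 5 * (n * n) ⇔ x ≤φ· n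
  sqrt5-criterion x n with n ≤? 2 * x
  ... | no n≰2x = subst (λ z → z * z ≤ 5 * (n * n) ⇔ x ≤φ· n) (sym 2x∸n≡0)
                        (mk⇔ (λ _ → ≤⇒≤φ· x≤n) (λ _ → z≤n))
    where
    x≤n : x ≤ n
    x≤n = ≤-trans (m≤m+n x (x + 0)) (<⇒≤ (≰⇒> n≰2x))
    2x∸n≡0 : 2 * x ∸ n ≡ 0
    2x∸n≡0 = m≤n⇒m∸n≡0 (<⇒≤ (≰⇒> n≰2x))
  ... | yes n≤2x with m≤n⇒∃[o]m+o≡n n≤2x
  ...   | d , n+d≡2x = subst (λ z → z * z ≤ 5 * (n * n) ⇔ x ≤φ· n) (sym 2x∸n≡d)
                             (mk⇔ d²≤⇒≤φ· ≤φ·⇒d²≤)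
    where
    open ≡-Reasoning
    2x∸n≡d : 2 * x ∸ n ≡ d
    2x∸n≡d = trans (cong (_∸ n) (sym n+d≡2x)) (m+n∸m≡n n d)
    excess : ℕ
    excess = n * n + 2 * (n * d)
    quad-lhs : 4 * (x * x) ≡ d * d + excess
    quad-lhs = begin
      4 * (x * x)         ≡⟨ four-square x ⟩
      (2 * x) * (2 * x)   ≡⟨ cong (λ z → z * z) (sym n+d≡2x) ⟩
      (n + d) * (n + d)   ≡⟨ sum-square n d ⟩
      d * d + excess      ∎
    quad-rhs : 4 * (x * n + n * n) ≡ 5 * (n * n) + excess
    quad-rhs = begin
      4 * (x * n + n * n)             ≡⟨ four-product x n ⟩
      2 * n * (2 * x) + 4 * (n * n)
        ≡⟨ cong (λ z → 2 * n * z + 4 * (n * n)) (sym n+d≡2x) ⟩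
      2 * n * (n + d) + 4 * (n * n)   ≡⟨ sum-product n d ⟩
      5 * (n * n) + excess            ∎
    d²≤⇒≤φ· : d * d ≤ 5 * (n * n) → x ≤φ· n
    d²≤⇒≤φ· h = *-cancelˡ-≤ 4
      (subst₂ _≤_ (sym quad-lhs) (sym quad-rhs) (+-monoˡ-≤ excess h))
    ≤φ·⇒d²≤ : x ≤φ· n → d * d ≤ 5 * (n * n)
    ≤φ·⇒d²≤ l = +-cancelʳ-≤ excess _ _
      (subst₂ _≤_ quad-lhs quad-rhs (*-monoʳ-≤ 4 l))

FloorPhi⇔IsFloorφ : ∀ n k → FloorPhi n k ⇔ IsFloorφ n k
FloorPhi⇔IsFloorφ n k = mk⇔
  (λ (lower , upper) → to (sqrt5-criterion k n) lower ,
     λ k+1≤φn → <⇒≱ upper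
       (from (sqrt5-criterion (k + 1) n) (subst (_≤φ· n) (+-comm 1 k) k+1≤φn)))
  (λ (k≤φn , k+1≰φn) → from (sqrt5-criterion k n) k≤φn ,
     ≰⇒> λ h → k+1≰φn
       (subst (_≤φ· n) (+-comm k 1) (to (sqrt5-criterion (k + 1) n) h)))
  where open Equivalence

wythoff⇔set : ∀ p → WythoffPair p ⇔ InWythoffSet p
wythoff⇔set (a , b) = mk⇔ to from
  where
  to : WythoffPair (a , b) → InWythoffSet (a , b)
  to (n , pair) = n , A n , Equivalence.from (FloorPhi⇔IsFloorφ n (A n)) (A-floor n) , pair
  from : InWythoffSet (a , b) → WythoffPair (a , b)
  from (n , k , floor , pair) with A-unique (Equivalence.to (FloorPhi⇔IsFloorφ n k) floor)
  ... | refl = n , pair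

-- The Wythoff pairs are the P-positions of both games: they are independent
-- for Wythoff moves, and absorbing already for R-Wythoff moves.
RWythoff-P⇔pair : ∀ p → IsP RMove p ⇔ WythoffPair p
RWythoff-P⇔pair = Kernel.P⇔kernel RMove RMove-terminating WythoffPair
  (λ mv → wythoff-independent (RMove⇒WMove mv)) wythoff-reachable

Wythoff-P⇔pair : ∀ p → IsP WMove p ⇔ WythoffPair p
Wythoff-P⇔pair = Kernel.P⇔kernel WMove WMove-terminating WythoffPair
  wythoff-independent absorbing
  where
  absorbing : ∀ p → WythoffPair p ⊎ ∃[ q ] (WMove p q × WythoffPair q)
  absorbing p with wythoff-reachable p
  ... | inj₁ pair = inj₁ pair
  ... | inj₂ (q , mv , pair) = inj₂ (q , RMove⇒WMove mv , pair)

theorem2p2 : ∀ p → (IsP RMove p ⇔ IsP WMove p) × (IsP RMove p ⇔ InWythoffSet p)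
theorem2p2 p = ⇔-sym (Wythoff-P⇔pair p) ⇔-∘ RWythoff-P⇔pair p
             , wythoff⇔set p ⇔-∘ RWythoff-P⇔pair p
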